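{- Let $T$ be a tournament containing $T_5$ or $P_7^-$. Then for any ordering $\sigma$ of $T$, at least two distinct vertices of $T$ are not paved in $B_\sigma(T)$.
   Context: Tournaments are finite; $T$ contains $S$ if some induced subtournament is isomorphic to $S$. $T_5$: vertices $v_1,\dots,v_5$, $v_iv_j$ an edge iff $j-i\equiv1,2\pmod5$. $P_7^-$: obtained by deleting one vertex from $P_7$, the tournament on $v_1,\dots,v_7$ with $v_iv_j$ an edge iff $j-i\equiv1,2,4\pmod7$. For an ordering $\sigma=(v_1,\dots,v_n)$, $B_\sigma(T)$ is the undirected graph on $V(T)$ with edges $v_iv_j$ for $i>j$ and $v_iv_j\in E(T)$. A vertex $v_i$ is paved in $B_\sigma(T)$ if it has at most one $B_\sigma(T)$-neighbour in $\{v_s:s<i\}$ and at most one in $\{v_t:t>i\}$. -}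

module Defs where

open import Data.Nat using (ℕ; zero; suc; _+_; _%_)
open import Data.Nat.Properties using ()
open import Data.Fin using (Fin; toℕ; inject₁; _<_)
open import Data.Bool using (Bool; true; false; _∨_)
open import Data.Product using (Σ; _×_; _,_; ∃-syntax)
open import Data.Sum using (_⊎_)
open import Relation.Binary.PropositionalEquality using (_≡_; _≢_)
open import Relation.Nullary using (¬_)
open import Function.Definitions using (Injective)
open import Data.Fin.Permutation using (Permutation′; _⟨$⟩ʳ_)

-- A (finite) tournament on the vertex set Fin size.
-- edge u v ≡ true means the arc u → v is present ("uv is an edge").
record Tournament : Set where
  field
    size    : ℕ
    edge    : Fin size → Fin size → Bool
    irrefl  : ∀ u → edge u u ≡ false
    total   : ∀ u v → u ≢ v → edge u v ≡ true ⊎ edge v u ≡ true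
    antisym : ∀ u v → edge u v ≡ true → edge v u ≡ false
open Tournament public

Contains : Tournament → (k : ℕ) → (Fin k → Fin k → Bool) → Set
Contains T k eS =
  Σ (Fin k → Fin (size T)) λ f →
    Injective _≡_ _≡_ f × (∀ u v → edge T (f u) (f v) ≡ eS u v)

open import Data.Nat using (_∸_; _≡ᵇ_)

-- (j - i) mod n, computed as (j + n - i) mod n for i < n
dmod : (n : ℕ) → .{{_ : Data.Nat.NonZero n}} → Fin n → Fin n → ℕ
dmod n i j = ((toℕ j + n) ∸ toℕ i) % n

T5edge : Fin 5 → Fin 5 → Bool
T5edge i j = (dmod 5 i j ≡ᵇ 1) ∨ (dmod 5 i j ≡ᵇ 2)

P7edge : Fin 7 → Fin 7 → Bool
P7edge i j = (dmod 7 i j ≡ᵇ 1) ∨ (dmod 7 i j ≡ᵇ 2) ∨ (dmod 7 i j ≡ᵇ 4)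

-- P_7^- : P_7 with its last vertex v_7 deleted (P_7 is vertex-transitive,
-- so this is P_7 minus any vertex up to isomorphism).
P7⁻edge : Fin 6 → Fin 6 → Bool
P7⁻edge i j = P7edge (inject₁ i) (inject₁ j)

-- An ordering σ = (v_1,…,v_n) of V(T): σ maps positions to vertices.
Ordering : Tournament → Set
Ordering T = Permutation′ (size T)

module _ (T : Tournament) (σ : Ordering T) where
  private
    v : Fin (size T) → Fin (size T)
    v i = σ ⟨$⟩ʳ i

  -- v_s is a B_σ(T)-neighbour of v_i with s < i : edge v_i v_s (i > s) in T
  LeftNbr : Fin (size T) → Fin (size T) → Set
  LeftNbr i s = s < i × edge T (v i) (v s) ≡ true

  -- v_t is a B_σ(T)-neighbour of v_i with t > i : edge v_t v_i (t > i) in T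
  RightNbr : Fin (size T) → Fin (size T) → Set
  RightNbr i t = i < t × edge T (v t) (v i) ≡ true

  Paved : Fin (size T) → Set
  Paved i = (∀ s s' → LeftNbr i s → LeftNbr i s' → s ≡ s')
          × (∀ t t' → RightNbr i t → RightNbr i t' → t ≡ t')

{-# OPTIONS --safe #-}
-- Every vertex of T₅ and of P₇⁻ has in- and out-degree at least 2. In a copy
-- of such a tournament inside T, the σ-first vertex of the copy has its two
-- in-neighbours later in σ, i.e. two B_σ(T)-neighbours to its right, and the
-- σ-last vertex has its two out-neighbours earlier, i.e. two B_σ(T)-neighbours
-- to its left; so neither is paved.
module Submission where

open import Defs
open import Data.Nat using (ℕ; suc)
open import Data.Nat.Properties using (<-≤-trans)
open import Data.Fin using (Fin; zero; suc; #_; _≤_; _<_)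
open import Data.Fin.Properties using (≤-totalOrder; ≤∧≢⇒<; <⇒≢)
open import Data.Fin.Permutation using (_⟨$⟩ʳ_; _⟨$⟩ˡ_; inverseʳ)
open import Data.List using (allFin)
open import Data.List.Relation.Unary.All using (lookup)
open import Data.List.Membership.Propositional.Properties using (∈-allFin)
open import Data.Bool using (Bool; true)
open import Data.Product using (Σ; _×_; _,_)
open import Data.Sum using (_⊎_; inj₁; inj₂)
open import Function using (_∘_)
open import Function.Definitions using (Injective)
open import Relation.Binary.PropositionalEquality
  using (_≡_; _≢_; refl; sym; trans; cong; module ≡-Reasoning)
open import Relation.Nullary using (¬_)

TwoDistinct : {A : Set} → (A → Set) → Set
TwoDistinct {A} P = Σ A λ a → Σ A λ b → a ≢ b × P a × P b

module _ {k : ℕ} (e : Fin k → Fin k → Bool) where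

  InDegree≥2 : Set
  InDegree≥2 = ∀ u → TwoDistinct (λ a → e a u ≡ true)

  OutDegree≥2 : Set
  OutDegree≥2 = ∀ u → TwoDistinct (λ a → e u a ≡ true)

module _ (T : Tournament) (σ : Ordering T) {i : Fin (size T)} where

  twoLeftNbrs⇒¬Paved : TwoDistinct (LeftNbr T σ i) → ¬ Paved T σ i
  twoLeftNbrs⇒¬Paved (s , s′ , s≢s′ , l , l′) (left , _) = s≢s′ (left s s′ l l′)

  twoRightNbrs⇒¬Paved : TwoDistinct (RightNbr T σ i) → ¬ Paved T σ i
  twoRightNbrs⇒¬Paved (t , t′ , t≢t′ , r , r′) (_ , right) = t≢t′ (right t t′ r r′)

module Embedded (T : Tournament) {k : ℕ} (e : Fin (suc k) → Fin (suc k) → Bool)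
  (f : Fin (suc k) → Fin (size T)) (f-injective : Injective _≡_ _≡_ f)
  (f-hom : ∀ u w → edge T (f u) (f w) ≡ e u w) (σ : Ordering T) where

  open import Data.List.Extrema (≤-totalOrder (size T))
    using (argmin; argmax; f[argmin]≤f[xs]; f[xs]≤f[argmax])

  position : Fin (suc k) → Fin (size T)
  position u = σ ⟨$⟩ˡ f u

  position-injective : Injective _≡_ _≡_ position
  position-injective {u} {w} eq = f-injective (begin
    f u               ≡⟨ sym (inverseʳ σ) ⟩
    σ ⟨$⟩ʳ position u ≡⟨ cong (σ ⟨$⟩ʳ_) eq ⟩
    σ ⟨$⟩ʳ position w ≡⟨ inverseʳ σ ⟩
    f w               ∎)
    where open ≡-Reasoning

  edge-position : ∀ u w → edge T (σ ⟨$⟩ʳ position u) (σ ⟨$⟩ʳ position w) ≡ e u w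
  edge-position u w rewrite inverseʳ σ {f u} | inverseʳ σ {f w} = f-hom u w

  arc⇒≢ : ∀ {u w} → e u w ≡ true → u ≢ w
  arc⇒≢ {u} euw refl with trans (sym (irrefl T (f u))) (trans (f-hom u u) euw)
  ... | ()

  arc⇒position≢ : ∀ {u w} → e u w ≡ true → position u ≢ position w
  arc⇒position≢ euw = arc⇒≢ euw ∘ position-injective

  first last : Fin (suc k)
  first = argmin position zero (allFin (suc k))
  last  = argmax position zero (allFin (suc k))

  first-≤ : ∀ u → position first ≤ position u
  first-≤ u = lookup (f[argmin]≤f[xs] {f = position} zero (allFin (suc k))) (∈-allFin u)

  ≤-last : ∀ u → position u ≤ position last
  ≤-last u = lookup (f[xs]≤f[argmax] {f = position} zero (allFin (suc k))) (∈-allFin u)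

  first-< : ∀ {a} → e a first ≡ true → position first < position a
  first-< {a} ea = ≤∧≢⇒< (first-≤ a) (arc⇒position≢ ea ∘ sym)

  <-last : ∀ {a} → e last a ≡ true → position a < position last
  <-last {a} ea = ≤∧≢⇒< (≤-last a) (arc⇒position≢ ea ∘ sym)

  inNbr-of-first : ∀ {a} → e a first ≡ true → RightNbr T σ (position first) (position a)
  inNbr-of-first ea = first-< ea , trans (edge-position _ first) ea

  outNbr-of-last : ∀ {a} → e last a ≡ true → LeftNbr T σ (position last) (position a)
  outNbr-of-last ea = <-last ea , trans (edge-position last _) ea

  first-¬Paved : InDegree≥2 e → ¬ Paved T σ (position first)
  first-¬Paved inDeg with inDeg first
  ... | a , b , a≢b , ea , eb = twoRightNbrs⇒¬Paved T σ
    (position a , position b , a≢b ∘ position-injective , inNbr-of-first ea , inNbr-of-first eb)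

  last-¬Paved : OutDegree≥2 e → ¬ Paved T σ (position last)
  last-¬Paved outDeg with outDeg last
  ... | a , b , a≢b , ea , eb = twoLeftNbrs⇒¬Paved T σ
    (position a , position b , a≢b ∘ position-injective , outNbr-of-last ea , outNbr-of-last eb)

  first≢last : InDegree≥2 e → position first ≢ position last
  first≢last inDeg with inDeg first
  ... | a , _ , _ , ea , _ = <⇒≢ (<-≤-trans (first-< ea) (≤-last a))

twoNotPaved : (T : Tournament) {k : ℕ} (e : Fin (suc k) → Fin (suc k) → Bool) →
  Contains T (suc k) e → InDegree≥2 e → OutDegree≥2 e → (σ : Ordering T) →
  Σ (Fin (size T)) λ i → Σ (Fin (size T)) λ j →
    i ≢ j × ¬ Paved T σ i × ¬ Paved T σ j
twoNotPaved T e (f , f-injective , f-hom) inDeg outDeg σ =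
  position first , position last , first≢last inDeg , first-¬Paved inDeg , last-¬Paved outDeg
  where open Embedded T e f f-injective f-hom σ

T₅-inDegree≥2 : InDegree≥2 T5edge
T₅-inDegree≥2 zero                         = # 3 , # 4 , (λ ()) , refl , refl
T₅-inDegree≥2 (suc zero)                   = # 0 , # 4 , (λ ()) , refl , refl
T₅-inDegree≥2 (suc (suc zero))             = # 0 , # 1 , (λ ()) , refl , refl
T₅-inDegree≥2 (suc (suc (suc zero)))       = # 1 , # 2 , (λ ()) , refl , refl
T₅-inDegree≥2 (suc (suc (suc (suc zero)))) = # 2 , # 3 , (λ ()) , refl , refl

T₅-outDegree≥2 : OutDegree≥2 T5edge
T₅-outDegree≥2 zero                         = # 1 , # 2 , (λ ()) , refl , refl
T₅-outDegree≥2 (suc zero)                   = # 2 , # 3 , (λ ()) , refl , refl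
T₅-outDegree≥2 (suc (suc zero))             = # 3 , # 4 , (λ ()) , refl , refl
T₅-outDegree≥2 (suc (suc (suc zero)))       = # 0 , # 4 , (λ ()) , refl , refl
T₅-outDegree≥2 (suc (suc (suc (suc zero)))) = # 0 , # 1 , (λ ()) , refl , refl

P₇⁻-inDegree≥2 : InDegree≥2 P7⁻edge
P₇⁻-inDegree≥2 zero                               = # 3 , # 5 , (λ ()) , refl , refl
P₇⁻-inDegree≥2 (suc zero)                         = # 0 , # 4 , (λ ()) , refl , refl
P₇⁻-inDegree≥2 (suc (suc zero))                   = # 0 , # 1 , (λ ()) , refl , refl
P₇⁻-inDegree≥2 (suc (suc (suc zero)))             = # 1 , # 2 , (λ ()) , refl , refl
P₇⁻-inDegree≥2 (suc (suc (suc (suc zero))))       = # 0 , # 2 , (λ ()) , refl , refl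
P₇⁻-inDegree≥2 (suc (suc (suc (suc (suc zero))))) = # 1 , # 3 , (λ ()) , refl , refl

P₇⁻-outDegree≥2 : OutDegree≥2 P7⁻edge
P₇⁻-outDegree≥2 zero                               = # 1 , # 2 , (λ ()) , refl , refl
P₇⁻-outDegree≥2 (suc zero)                         = # 2 , # 3 , (λ ()) , refl , refl
P₇⁻-outDegree≥2 (suc (suc zero))                   = # 3 , # 4 , (λ ()) , refl , refl
P₇⁻-outDegree≥2 (suc (suc (suc zero)))             = # 0 , # 4 , (λ ()) , refl , refl
P₇⁻-outDegree≥2 (suc (suc (suc (suc zero))))       = # 1 , # 5 , (λ ()) , refl , refl
P₇⁻-outDegree≥2 (suc (suc (suc (suc (suc zero))))) = # 0 , # 2 , (λ ()) , refl , refl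

proposition4p5 : (T : Tournament) → Contains T 5 T5edge ⊎ Contains T 6 P7⁻edge →
    (σ : Ordering T) →
    Σ (Fin (size T)) λ i → Σ (Fin (size T)) λ j →
      i ≢ j × ¬ Paved T σ i × ¬ Paved T σ j
proposition4p5 T (inj₁ T₅⊆T)  = twoNotPaved T T5edge T₅⊆T T₅-inDegree≥2 T₅-outDegree≥2
proposition4p5 T (inj₂ P₇⁻⊆T) = twoNotPaved T P7⁻edge P₇⁻⊆T P₇⁻-inDegree≥2 P₇⁻-outDegree≥2
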